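{- Let $J\subseteq C(n,k)$ be a realizable $k$-set, let $U=J_s$, and let $U'\subseteq C(n,k+1)$ be any realizable $(k+1)$-set with $U\subseteq U'\subseteq J_s\cup J_F$. Then $U'_F\cap U_s=\emptyset$.
   Context: $C(n,m)$: $m$-subsets of $\{1,\dots,n\}$ with lexicographic order on increasing sequences. For $X\in C(n,m+1)$, $P_X=\{Y\in C(n,m):Y\subset X\}$ with induced lexicographic order; prefix/suffix = initial/final segment. For $A\subseteq C(n,m)$ define subsets of $C(n,m+1)$: $A_p$ (resp. $A_s$) = $\{X:P_X\cap A$ a nonempty prefix (resp. suffix) of $P_X$ different from $P_X\}$, $A_F=\{X:P_X\subseteq A\}$, $A_\emptyset=\{X:P_X\cap A=\emptyset\}$. $A$ is realizable if $P_X\cap A$ is a prefix or suffix of $P_X$ for every $X\in C(n,m+1)$. -}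

module Defs where

open import Level using (0ℓ)
open import Data.Nat using (ℕ; suc; _≤_; _<_)
open import Data.List using (List; length)
open import Data.List.Relation.Unary.All using (All)
open import Data.List.Relation.Unary.Linked using (Linked)
open import Data.List.Relation.Binary.Subset.Propositional using (_⊆_)
open import Data.List.Relation.Binary.Lex.Strict using (Lex-≤)
open import Data.Product using (_×_; ∃)
open import Data.Sum using (_⊎_)
open import Relation.Nullary using (¬_)
open import Relation.Binary.PropositionalEquality using (_≡_)

-- An m-subset of {1,…,n}, represented by its strictly increasing sequence
-- of elements.
Comb : ℕ → ℕ → List ℕ → Set
Comb n m xs = Linked _<_ xs × All (λ x → 1 ≤ x × x ≤ n) xs × length xs ≡ m

Family : Set₁
Family = List ℕ → Set

_≤lex_ : List ℕ → List ℕ → Set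
_≤lex_ = Lex-≤ _≡_ _<_

InP : ℕ → ℕ → List ℕ → List ℕ → Set
InP n m X Y = Comb n m Y × Y ⊆ X

IsPrefix : ℕ → ℕ → Family → List ℕ → Set
IsPrefix n m A X = ∀ Y Z → InP n m X Y → InP n m X Z → Y ≤lex Z → A Z → A Y

IsSuffix : ℕ → ℕ → Family → List ℕ → Set
IsSuffix n m A X = ∀ Y Z → InP n m X Y → InP n m X Z → Y ≤lex Z → A Y → A Z

Meets : ℕ → ℕ → Family → List ℕ → Set
Meets n m A X = ∃ λ Y → InP n m X Y × A Y

Contains : ℕ → ℕ → Family → List ℕ → Set
Contains n m A X = ∀ Y → InP n m X Y → A Y

FamilyOf : ℕ → ℕ → Family → Set
FamilyOf n m A = ∀ Y → A Y → Comb n m Y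

Pref : ℕ → ℕ → Family → Family
Pref n m A X = Comb n (suc m) X × IsPrefix n m A X × Meets n m A X × ¬ Contains n m A X

Suff : ℕ → ℕ → Family → Family
Suff n m A X = Comb n (suc m) X × IsSuffix n m A X × Meets n m A X × ¬ Contains n m A X

Full : ℕ → ℕ → Family → Family
Full n m A X = Comb n (suc m) X × Contains n m A X

Empty : ℕ → ℕ → Family → Family
Empty n m A X = Comb n (suc m) X × ¬ Meets n m A X

Realizable : ℕ → ℕ → Family → Set
Realizable n m A = ∀ X → Comb n (suc m) X → IsPrefix n m A X ⊎ IsSuffix n m A X

-- In P_X the lexicographically least element is X with its largest element
-- dropped, so a suffix of P_X containing it is all of P_X; hence for
-- X ∈ A_s the set X minus its largest element is never in A.
-- Now let X ∈ U'_F ∩ (J_s)_s and W = X minus its maximum. Then W ∈ U' but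
-- W ∉ J_s, so W ∈ J_F. Pick Z ∈ P_X ∩ J_s; Z minus its maximum lies in P_W,
-- hence in J, contradicting Z ∈ J_s.
module Submission where

open import Defs
open import Data.Nat using (ℕ; suc; pred; _<_)
open import Data.Nat.Properties using (<-trans; <-irrefl; <-asym)
open import Data.List using (List; []; _∷_; length)
open import Data.List.Relation.Unary.All.Properties using (anti-mono)
open import Data.List.Relation.Unary.AllPairs using (_∷_)
open import Data.List.Relation.Unary.Any using (here; there)
open import Data.List.Relation.Unary.Linked as Linked using (Linked; []; [-]; _∷_)
open import Data.List.Relation.Unary.Linked.Properties using (Linked⇒AllPairs)
open import Data.List.Membership.Propositional using (_∈_)
open import Data.List.Relation.Binary.Subset.Propositional using (_⊆_)
open import Data.List.Relation.Binary.Lex.Core using (base; this; next)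
open import Data.Product using (_×_; _,_; ∃; proj₁; proj₂)
open import Data.Sum using (_⊎_; inj₁; inj₂)
open import Data.Unit using (tt)
open import Data.Empty using (⊥-elim)
open import Function using (_∘_)
open import Level using (Level)
open import Relation.Binary using (Rel)
open import Relation.Nullary using (¬_)
open import Relation.Binary.PropositionalEquality using (_≡_; refl; cong)
import Data.List.Relation.Unary.All as All

private variable
  A : Set
  x z w : ℕ
  xs X Y : List ℕ
  n m : ℕ

dropLast : List A → List A
dropLast []           = []
dropLast (x ∷ [])     = []
dropLast (x ∷ y ∷ xs) = x ∷ dropLast (y ∷ xs)

dropLast-⊆ : (xs : List A) → dropLast xs ⊆ xs
dropLast-⊆ (x ∷ y ∷ xs) (here x≡) = here x≡
dropLast-⊆ (x ∷ y ∷ xs) (there v) = there (dropLast-⊆ (y ∷ xs) v)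

length-dropLast : (xs : List A) → length xs ≡ suc m → length (dropLast xs) ≡ m
length-dropLast (x ∷ [])     refl = refl
length-dropLast (x ∷ y ∷ xs) refl = cong suc (length-dropLast (y ∷ xs) refl)

dropLast⁺ : {ℓ : Level} {R : Rel A ℓ} {xs : List A} → Linked R xs → Linked R (dropLast xs)
dropLast⁺ []               = []
dropLast⁺ [-]              = []
dropLast⁺ (Rxy ∷ [-])      = [-]
dropLast⁺ (Rxy ∷ Ryz ∷ Rs) = Rxy ∷ dropLast⁺ (Ryz ∷ Rs)

head-<-∈ : Linked _<_ (x ∷ xs) → z ∈ xs → x < z
head-<-∈ sorted with Linked⇒AllPairs <-trans sorted
... | x<xs ∷ _ = All.lookup x<xs

∈-dropLast⁻ : Linked _<_ Y → z ∈ dropLast Y → ∃ λ w → w ∈ Y × z < w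
∈-dropLast⁻ {x ∷ y ∷ _} (x<y ∷ _)    (here refl) = y , there (here refl) , x<y
∈-dropLast⁻ {x ∷ y ∷ _} (_ ∷ sorted) (there z∈)  with ∈-dropLast⁻ sorted z∈
... | w , w∈ , z<w = w , there w∈ , z<w

∈-dropLast⁺ : Linked _<_ X → z ∈ X → w ∈ X → z < w → z ∈ dropLast X
∈-dropLast⁺ {x ∷ []}    _      (here refl) (here refl) z<w = ⊥-elim (<-irrefl refl z<w)
∈-dropLast⁺ {x ∷ _ ∷ _} _      (here z≡)   _           _   = here z≡
∈-dropLast⁺ {x ∷ _ ∷ _} sorted (there z∈)  (here refl) z<w =
  ⊥-elim (<-asym z<w (head-<-∈ sorted z∈))
∈-dropLast⁺ {x ∷ _ ∷ _} sorted (there z∈)  (there w∈)  z<w =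
  there (∈-dropLast⁺ (Linked.tail sorted) z∈ w∈ z<w)

dropLast-mono-⊆ : Linked _<_ X → Linked _<_ Y → Y ⊆ X → dropLast Y ⊆ dropLast X
dropLast-mono-⊆ sortedX sortedY Y⊆X z∈ with ∈-dropLast⁻ sortedY z∈
... | w , w∈ , z<w = ∈-dropLast⁺ sortedX (Y⊆X (dropLast-⊆ _ z∈)) (Y⊆X w∈) z<w

dropLast-≤lex : Linked _<_ X → Linked _<_ Y → length X ≡ suc (length Y) →
                Y ⊆ X → dropLast X ≤lex Y
dropLast-≤lex {_ ∷ []}    {[]}    _       _       _  _   = base tt
dropLast-≤lex {x ∷ _ ∷ _} {y ∷ Y} sortedX sortedY eq Y⊆X with Y⊆X (here refl)
... | there y∈ = this (head-<-∈ sortedX y∈)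
... | here refl =
  next refl (dropLast-≤lex (Linked.tail sortedX) (Linked.tail sortedY)
                           (cong pred eq) Y⊆tail)
  where
  Y⊆tail : Y ⊆ _
  Y⊆tail z∈ with Y⊆X (there z∈)
  ... | here refl = ⊥-elim (<-irrefl refl (head-<-∈ sortedY z∈))
  ... | there z∈′ = z∈′

dropLast-InP : Comb n (suc m) X → InP n m X (dropLast X)
dropLast-InP {X = X} (sorted , bounded , len) =
  (dropLast⁺ sorted , anti-mono (dropLast-⊆ X) bounded , length-dropLast X len)
  , dropLast-⊆ X

dropLast-least : Comb n (suc m) X → InP n m X Y → dropLast X ≤lex Y
dropLast-least (sortedX , _ , lenX) ((sortedY , _ , refl) , Y⊆X) =
  dropLast-≤lex sortedX sortedY lenX Y⊆X

suffix-∋-least⇒Contains : {F : Family} → Comb n (suc m) X → IsSuffix n m F X →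
                          F (dropLast X) → Contains n m F X
suffix-∋-least⇒Contains cX suffix F-least Y Y∈P =
  suffix _ Y (dropLast-InP cX) Y∈P (dropLast-least cX Y∈P) F-least

Suff⇒¬least : {F : Family} → Suff n m F X → ¬ F (dropLast X)
Suff⇒¬least (cX , suffix , _ , notFull) = notFull ∘ suffix-∋-least⇒Contains cX suffix

lemma4p14 : (n k : ℕ) (J U' : Family) →
    FamilyOf n k J → Realizable n k J →
    FamilyOf n (suc k) U' → Realizable n (suc k) U' →
    (∀ X → Suff n k J X → U' X) →
    (∀ X → U' X → Suff n k J X ⊎ Full n k J X) →
    ∀ (X : List ℕ) → ¬ (Full n (suc k) U' X × Suff n (suc k) (Suff n k J) X)
lemma4p14 n k J U' _ _ _ _ _ U'⊆Js∪JF X ((cX , X∈U'F) , X∈Jss@(_ , _ , (Z , Z∈PX , Z∈Js) , _))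
  with U'⊆Js∪JF (dropLast X) (X∈U'F _ (dropLast-InP cX))
... | inj₁ W∈Js = Suff⇒¬least X∈Jss W∈Js
... | inj₂ (_ , W∈JF) = Suff⇒¬least Z∈Js (W∈JF _ Z′∈PW)
  where
  cZ = proj₁ Z∈Js
  Z′∈PW : InP n k (dropLast X) (dropLast Z)
  Z′∈PW = proj₁ (dropLast-InP cZ)
        , dropLast-mono-⊆ (proj₁ cX) (proj₁ cZ)
                          (proj₂ Z∈PX)
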